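{- Let $p\geq 3$ be a prime, $k\in \{3,4,\dots,p\}$ and $n\in \mathbb{N}$. Then $$r_k(\mathbb{F}_p^{n+1})\leq \frac{2(p^{n+1}-1)r_k(\mathbb{F}_p^n)+p^n-\sqrt{4(p^{n+1}-1)r_k(\mathbb{F}_p^n)\bigl(p^n-r_k(\mathbb{F}_p^n)\bigr)+p^{2n}}}{2p^n}.$$
   Context: For a prime $p$, an integer $k$ with $3\le k\le p$ and $m\in\mathbb{N}$, a $k$-progression in $\mathbb{F}_p^m$ is a set of $k$ points of the form $\{a+ib : i\in\{0,1,\dots,k-1\}\}$ with $a,b\in\mathbb{F}_p^m$, $b\neq 0$. $r_k(\mathbb{F}_p^m)$ denotes the maximum cardinality of a subset of $\mathbb{F}_p^m$ containing no $k$-progression. -}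

module Defs where

open import Data.Nat using (ℕ; zero; suc; _+_; _*_; _∸_; _^_; _≤_; _<_)
open import Data.Nat.DivMod using (_mod_)
open import Data.Fin using (Fin; toℕ)
open import Data.Vec using (Vec; []; _∷_; zipWith; map; lookup)
open import Data.List using (List; [_]; concatMap; allFin)
open import Data.Nat.ListAction using (sum)
import Data.List as L
open import Data.Bool using (Bool; true; false; if_then_else_)
open import Data.Product using (Σ; _×_; ∃)
open import Relation.Binary.PropositionalEquality using (_≡_)
open import Relation.Nullary using (¬_)

addF : {p : ℕ} → Fin p → Fin p → Fin p
addF {suc q} x y = (toℕ x + toℕ y) mod suc q

smulF : {p : ℕ} → ℕ → Fin p → Fin p
smulF {suc q} i x = (i * toℕ x) mod suc q

Pt : ℕ → ℕ → Set
Pt p m = Vec (Fin p) m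

_⊕_ : {p m : ℕ} → Pt p m → Pt p m → Pt p m
a ⊕ b = zipWith addF a b

_⊙_ : {p m : ℕ} → ℕ → Pt p m → Pt p m
i ⊙ b = map (smulF i) b

NonZeroVec : {p m : ℕ} → Pt p m → Set
NonZeroVec {p} {m} b = ¬ ((j : Fin m) → toℕ (lookup b j) ≡ 0)

SubsetF : ℕ → ℕ → Set
SubsetF p m = Pt p m → Bool

allPts : (p m : ℕ) → List (Pt p m)
allPts p zero = [ [] ]
allPts p (suc m) = concatMap (λ x → L.map (x ∷_) (allPts p m)) (allFin p)

card : {p m : ℕ} → SubsetF p m → ℕ
card {p} {m} S = sum (L.map (λ v → if S v then 1 else 0) (allPts p m))

ContainsProg : {p m : ℕ} → ℕ → SubsetF p m → Set
ContainsProg {p} {m} k S =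
  Σ (Pt p m) λ a → Σ (Pt p m) λ b →
    NonZeroVec b × ((i : ℕ) → i < k → S (a ⊕ (i ⊙ b)) ≡ true)

ProgFree : {p m : ℕ} → ℕ → SubsetF p m → Set
ProgFree k S = ¬ ContainsProg k S

IsRk : ℕ → ℕ → ℕ → ℕ → Set
IsRk p k m R =
  (Σ (SubsetF p m) λ S → ProgFree k S × card S ≡ R)
  × ((S : SubsetF p m) → ProgFree k S → card S ≤ R)

-- x ≤ (A - √B) / C  (for C > 0), with the square root eliminated:
-- equivalent to  C·x ≤ A  and  B ≤ (A - C·x)².
LeqMinusSqrtOver : (x A B C : ℕ) → Set
LeqMinusSqrtOver x A B C = (C * x ≤ A) × (B ≤ (A ∸ C * x) * (A ∸ C * x))

-- Fix a nonzero c ∈ 𝔽ₚⁿ⁺¹. The sections S ∩ {v : c · v = t}, t ∈ 𝔽ₚ, partition S, and each is the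
-- image of a progression-free subset of 𝔽ₚⁿ under an affine bijection, so has size at most
-- R = r_k(𝔽ₚⁿ); consequently each also has size at least m = |S| − (p − 1)R. Summing
-- (s − m)(R − s) ≥ 0 over the sections s of all Z = pⁿ⁺¹ − 1 directions c, and computing Σ s²
-- exactly by counting the pairs u, v ∈ S with c · u = c · v, yields T(|S|) ≥ 0 for the quadratic
-- T(X) = pⁿX² − (2ZR + pⁿ)X + pZR². As T(pR) = −pR(pⁿ − R) ≤ 0 while |S| ≤ pR and |S| < pⁿ⁺¹,
-- |S| cannot lie right of the vertex of T, so it is at most the smaller root: the stated bound.

module Submission where

module IntegerIdentities where

  import Data.Nat.Base as ℕ
  open import Data.Integer.Base using (ℤ; +_; _+_; _*_; _-_; _≤_)
  open import Data.Integer.Properties using (pos-+; pos-*; +-comm; +-injective; drop‿+≤+)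
  open import Data.Integer.Tactic.RingSolver using (solve-∀)
  open import Relation.Binary.PropositionalEquality using (_≡_; refl; sym; trans; cong; cong₂; subst₂)

  infixl 6 _‵+_
  infixl 7 _‵*_
  infix  8 ‵_

  data Expr : Set where
    ‵_        : ℕ.ℕ → Expr
    _‵+_ _‵*_ : Expr → Expr → Expr

  ⟦_⟧ℕ : Expr → ℕ.ℕ
  ⟦ ‵ a ⟧ℕ    = a
  ⟦ e ‵+ f ⟧ℕ = ⟦ e ⟧ℕ ℕ.+ ⟦ f ⟧ℕ
  ⟦ e ‵* f ⟧ℕ = ⟦ e ⟧ℕ ℕ.* ⟦ f ⟧ℕ

  ⟦_⟧ℤ : Expr → ℤ
  ⟦ ‵ a ⟧ℤ    = + a
  ⟦ e ‵+ f ⟧ℤ = ⟦ e ⟧ℤ + ⟦ f ⟧ℤ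
  ⟦ e ‵* f ⟧ℤ = ⟦ e ⟧ℤ * ⟦ f ⟧ℤ

  +⟦_⟧ℕ : ∀ e → + ⟦ e ⟧ℕ ≡ ⟦ e ⟧ℤ
  +⟦ ‵ a ⟧ℕ    = refl
  +⟦ e ‵+ f ⟧ℕ = trans (pos-+ ⟦ e ⟧ℕ ⟦ f ⟧ℕ) (cong₂ _+_ +⟦ e ⟧ℕ +⟦ f ⟧ℕ)
  +⟦ e ‵* f ⟧ℕ = trans (pos-* ⟦ e ⟧ℕ ⟦ f ⟧ℕ) (cong₂ _*_ +⟦ e ⟧ℕ +⟦ f ⟧ℕ)

  cast : ∀ e f → ⟦ e ⟧ℕ ≡ ⟦ f ⟧ℕ → ⟦ e ⟧ℤ ≡ ⟦ f ⟧ℤ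
  cast e f e≡f = trans (sym +⟦ e ⟧ℕ) (trans (cong +_ e≡f) +⟦ f ⟧ℕ)

  uncast : ∀ e f → ⟦ e ⟧ℤ ≡ ⟦ f ⟧ℤ → ⟦ e ⟧ℕ ≡ ⟦ f ⟧ℕ
  uncast e f e≡f = +-injective (trans +⟦ e ⟧ℕ (trans e≡f (sym +⟦ f ⟧ℕ)))

  uncast-≤ : ∀ e f → ⟦ e ⟧ℤ ≤ ⟦ f ⟧ℤ → ⟦ e ⟧ℕ ℕ.≤ ⟦ f ⟧ℕ
  uncast-≤ e f e≤f = drop‿+≤+ (subst₂ _≤_ (sym +⟦ e ⟧ℕ) (sym +⟦ f ⟧ℕ) e≤f)

  -- The quadratic of the proof idea, for the prime 1 + Q, N = pⁿ and Z = pⁿ⁺¹ − 1.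
  T : (N Z Q R X : ℤ) → ℤ
  T N Z Q R X = N * X * X + (+ 1 + Q) * Z * R * R - (+ 2 * Z * R + N) * X

  private
    isolate : ∀ (a b c : ℤ) → a + b ≡ c → a ≡ c - b
    isolate a b c a+b≡c = trans (a≡a+b-b a b) (cong (_- b) a+b≡c)
      where
      a≡a+b-b : ∀ a b → a ≡ (a + b) - b
      a≡a+b-b = solve-∀

  Q*T≡ : ∀ (X R M N Q W Z G E F : ℤ) →
         W + Z * ((+ 1 + Q) * (R * M)) + G ≡ Z * ((R + M) * X) →
         W + X * X ≡ N * (X * X) + Q * N * X →
         Z + + 1 ≡ (+ 1 + Q) * N →
         X + E ≡ M + Q * R →
         M + F ≡ R →
         Q * T N Z Q R X ≡ G + E * Z * (E + F)
  Q*T≡ X R M N Q W Z G E F h₁ h₂ h₃ h₄ h₅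
    rewrite isolate G (W + Z * ((+ 1 + Q) * (R * M))) _ (trans (+-comm G _) h₁)
          | isolate W (X * X) _ h₂
          | isolate Z (+ 1) _ h₃
          | isolate E X _ (trans (+-comm E X) h₄)
          | isolate F M _ (trans (+-comm F M) h₅) = identity X R M N Q
    where
    identity : ∀ X R M N Q →
      Q * (N * X * X + (+ 1 + Q) * ((+ 1 + Q) * N - + 1) * R * R - (+ 2 * ((+ 1 + Q) * N - + 1) * R + N) * X) ≡
        ((+ 1 + Q) * N - + 1) * ((R + M) * X) - ((N * (X * X) + Q * N * X) - X * X + ((+ 1 + Q) * N - + 1) * ((+ 1 + Q) * (R * M)))
        + (M + Q * R - X) * ((+ 1 + Q) * N - + 1) * ((M + Q * R - X) + (R - M))
    identity = solve-∀

  T+…≡0 : ∀ (X R N Q Z H W U S : ℤ) →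
          Z + + 1 ≡ (+ 1 + Q) * N → R + H ≡ N → X + W ≡ (+ 1 + Q) * R →
          + 1 + (+ 2 * Z * R + N) + U ≡ + 2 * N * X →
          (+ 2 * Z * R + N) * X + S ≡ N * X * X + (+ 1 + Q) * Z * R * R →
          S + (+ 1 + Q) * R * H + W * (+ 1 + U + N * W) ≡ + 0
  T+…≡0 X R N Q Z H W U S h₁ h₂ h₃ h₄ h₅
    rewrite isolate S ((+ 2 * Z * R + N) * X) _ (trans (+-comm S _) h₅)
          | isolate U (+ 1 + (+ 2 * Z * R + N)) _ (trans (+-comm U _) h₄)
          | isolate Z (+ 1) _ h₁
          | isolate H R _ (trans (+-comm H R) h₂)
          | isolate W X _ (trans (+-comm W X) h₃) = identity X R N Q
    where
    identity : ∀ X R N Q →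
      N * X * X + (+ 1 + Q) * ((+ 1 + Q) * N - + 1) * R * R - (+ 2 * ((+ 1 + Q) * N - + 1) * R + N) * X
      + (+ 1 + Q) * R * (N - R)
      + ((+ 1 + Q) * R - X) * (+ 1 + (+ 2 * N * X - (+ 1 + (+ 2 * ((+ 1 + Q) * N - + 1) * R + N))) + N * ((+ 1 + Q) * R - X))
      ≡ + 0
    identity = solve-∀

  D*D≡ : ∀ (X R N Q Z H D S : ℤ) →
         Z + + 1 ≡ (+ 1 + Q) * N → R + H ≡ N → + 2 * N * X + D ≡ + 2 * Z * R + N →
         (+ 2 * Z * R + N) * X + S ≡ N * X * X + (+ 1 + Q) * Z * R * R →
         D * D ≡ + 4 * Z * R * H + N * N + + 4 * N * S
  D*D≡ X R N Q Z H D S h₁ h₂ h₃ h₄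
    rewrite isolate S ((+ 2 * Z * R + N) * X) _ (trans (+-comm S _) h₄)
          | isolate D (+ 2 * N * X) _ (trans (+-comm D _) h₃)
          | isolate Z (+ 1) _ h₁
          | isolate H R _ (trans (+-comm H R) h₂) = identity X R N Q
    where
    identity : ∀ X R N Q →
      (+ 2 * ((+ 1 + Q) * N - + 1) * R + N - + 2 * N * X) * (+ 2 * ((+ 1 + Q) * N - + 1) * R + N - + 2 * N * X)
      ≡ + 4 * ((+ 1 + Q) * N - + 1) * R * (N - R) + N * N
        + + 4 * N * (N * X * X + (+ 1 + Q) * ((+ 1 + Q) * N - + 1) * R * R - (+ 2 * ((+ 1 + Q) * N - + 1) * R + N) * X)
    identity = solve-∀

open import Data.Bool using (Bool; true; false; if_then_else_; _∧_)
open import Data.Empty using (⊥-elim)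
open import Data.Fin using (Fin; zero; suc; toℕ; fromℕ<; _≟_)
open import Data.Fin.Properties using (toℕ<n; toℕ-injective; toℕ-fromℕ<)
open import Data.List using (List; []; _∷_; _++_; map; concatMap; allFin; length)
import Data.List.Properties as List
open import Data.Nat hiding (_≟_)
open import Data.Nat.Coprimality as Coprime using (coprime-Bézout; prime⇒coprime)
open import Data.Nat.DivMod
open import Data.Nat.GCD using (module Bézout)
open import Data.Nat.ListAction using (sum)
open import Data.Nat.ListAction.Properties using (sum-++)
open import Data.Nat.Primality using (Prime; prime⇒nonTrivial)
open import Data.Nat.Properties hiding (_≟_)
open import Data.Nat.Tactic.RingSolver renaming (solve-∀ to ℕ-solve-∀)
open import Data.Product using (∃; _×_; _,_; proj₁; proj₂; uncurry)
open import Data.Sum using (inj₁; inj₂; [_,_]′)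
open import Data.Vec using ([]; _∷_; replicate; lookup)
open import Data.Vec.Properties using (≡-dec; ∷-injective; lookup-replicate)
open import Function using (_∘_; id; _⇔_; mk⇔; Equivalence)
open import Function.Properties.Equivalence using (⇔-setoid)
open import Level using (0ℓ)
open import Relation.Binary.Bundles using (Setoid)
open import Relation.Binary.PropositionalEquality
import Relation.Binary.Reasoning.Setoid as SetoidReasoning
open import Relation.Nullary using (¬_; Dec; yes; no; does)
open import Relation.Nullary.Decidable using (does-⇔; dec-true)

open import Defs

∑ : {A : Set} → List A → (A → ℕ) → ℕ
∑ xs f = sum (map f xs)

infix 5 ∑
syntax ∑ xs (λ x → e) = ∑[ x ∈ xs ] e

private variable X Y : Set

∑-cong : (xs : List X) {f g : X → ℕ} → (∀ x → f x ≡ g x) → ∑ xs f ≡ ∑ xs g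
∑-cong []       f≗g = refl
∑-cong (x ∷ xs) f≗g = cong₂ _+_ (f≗g x) (∑-cong xs f≗g)

∑-mono-≤ : (xs : List X) {f g : X → ℕ} → (∀ x → f x ≤ g x) → ∑ xs f ≤ ∑ xs g
∑-mono-≤ []       f≤g = z≤n
∑-mono-≤ (x ∷ xs) f≤g = +-mono-≤ (f≤g x) (∑-mono-≤ xs f≤g)

∑-zero : (xs : List X) → ∑[ x ∈ xs ] 0 ≡ 0
∑-zero []       = refl
∑-zero (x ∷ xs) = ∑-zero xs

∑-const : (xs : List X) (k : ℕ) → ∑[ x ∈ xs ] k ≡ length xs * k
∑-const []       k = refl
∑-const (x ∷ xs) k = cong (k +_) (∑-const xs k)

∑-distrib-+ : (xs : List X) (f g : X → ℕ) → ∑[ x ∈ xs ] (f x + g x) ≡ ∑ xs f + ∑ xs g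
∑-distrib-+ []       f g = refl
∑-distrib-+ (x ∷ xs) f g = begin
  f x + g x + (∑[ y ∈ xs ] (f y + g y)) ≡⟨ cong (f x + g x +_) (∑-distrib-+ xs f g) ⟩
  f x + g x + (∑ xs f + ∑ xs g)       ≡⟨ +-exchange (f x) (g x) (∑ xs f) (∑ xs g) ⟩
  f x + ∑ xs f + (g x + ∑ xs g)       ∎
  where
  open ≡-Reasoning
  +-exchange : ∀ a b c d → a + b + (c + d) ≡ a + c + (b + d)
  +-exchange = ℕ-solve-∀

∑-*ˡ : (xs : List X) (k : ℕ) (f : X → ℕ) → ∑[ x ∈ xs ] (k * f x) ≡ k * ∑ xs f
∑-*ˡ []       k f = sym (*-zeroʳ k)
∑-*ˡ (x ∷ xs) k f = trans (cong (k * f x +_) (∑-*ˡ xs k f)) (sym (*-distribˡ-+ k (f x) (∑ xs f)))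

∑-*ʳ : (xs : List X) (k : ℕ) (f : X → ℕ) → ∑[ x ∈ xs ] (f x * k) ≡ ∑ xs f * k
∑-*ʳ xs k f = trans (∑-cong xs (λ x → *-comm (f x) k)) (trans (∑-*ˡ xs k f) (*-comm k (∑ xs f)))

∑-square : (xs : List X) (f : X → ℕ) → ∑ xs f * ∑ xs f ≡ ∑[ u ∈ xs ] ∑[ v ∈ xs ] (f u * f v)
∑-square xs f = trans (sym (∑-*ʳ xs (∑ xs f) f)) (∑-cong xs (λ u → sym (∑-*ˡ xs (f u) f)))

∑-if : (xs : List X) (b : Bool) (f : X → ℕ) → ∑[ x ∈ xs ] (if b then f x else 0) ≡ (if b then ∑ xs f else 0)
∑-if xs true  f = refl
∑-if xs false f = ∑-zero xs

∑-comm : (xs : List X) (ys : List Y) (f : X → Y → ℕ) →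
         ∑[ x ∈ xs ] ∑[ y ∈ ys ] f x y ≡ ∑[ y ∈ ys ] ∑[ x ∈ xs ] f x y
∑-comm []       ys f = sym (∑-zero ys)
∑-comm (x ∷ xs) ys f = trans (cong (∑ ys (f x) +_) (∑-comm xs ys f))
                             (sym (∑-distrib-+ ys (f x) (λ y → ∑[ x′ ∈ xs ] f x′ y)))

∑-map : (xs : List X) (h : X → Y) (f : Y → ℕ) → ∑ (map h xs) f ≡ ∑ xs (f ∘ h)
∑-map xs h f = cong sum (sym (List.map-∘ xs))

∑-concatMap : (xs : List X) (g : X → List Y) (f : Y → ℕ) →
              ∑ (concatMap g xs) f ≡ ∑[ x ∈ xs ] ∑ (g x) f
∑-concatMap []       g f = refl
∑-concatMap (x ∷ xs) g f = begin
  sum (map f (g x ++ concatMap g xs))          ≡⟨ cong sum (List.map-++ f (g x) _) ⟩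
  sum (map f (g x) ++ map f (concatMap g xs))  ≡⟨ sum-++ (map f (g x)) _ ⟩
  ∑ (g x) f + ∑ (concatMap g xs) f                  ≡⟨ cong (∑ (g x) f +_) (∑-concatMap xs g f) ⟩
  ∑ (g x) f + (∑[ y ∈ xs ] ∑ (g y) f)               ∎
  where open ≡-Reasoning

𝟙 : Bool → ℕ
𝟙 b = if b then 1 else 0

𝟙≤1 : ∀ b → 𝟙 b ≤ 1
𝟙≤1 true  = ≤-refl
𝟙≤1 false = z≤n

𝟙*𝟙 : ∀ b → 𝟙 b * 𝟙 b ≡ 𝟙 b
𝟙*𝟙 true  = refl
𝟙*𝟙 false = refl

∑-allFin-suc : ∀ {n} (f : Fin (suc n) → ℕ) → ∑ (allFin (suc n)) f ≡ f zero + ∑ (allFin n) (f ∘ suc)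
∑-allFin-suc {n} f = cong (λ xs → f zero + sum xs)
  (trans (List.map-tabulate suc f) (sym (List.map-tabulate id (f ∘ suc))))

∑-δ : ∀ {n} (y : Fin n) (h : Fin n → ℕ) → ∑[ x ∈ allFin n ] (if does (x ≟ y) then h x else 0) ≡ h y
∑-δ {suc n} zero    h = trans (∑-allFin-suc (λ x → if does (x ≟ zero) then h x else 0))
                              (trans (cong (h zero +_) (∑-zero (allFin n))) (+-identityʳ _))
∑-δ {suc n} (suc y) h = trans (∑-allFin-suc (λ x → if does (x ≟ suc y) then h x else 0)) (∑-δ y (h ∘ suc))

∑-allPts-suc : ∀ {p} m (f : Pt p (suc m) → ℕ) →
               ∑ (allPts p (suc m)) f ≡ ∑[ x ∈ allFin p ] ∑[ w ∈ allPts p m ] f (x ∷ w)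
∑-allPts-suc {p} m f = trans (∑-concatMap (allFin p) (λ x → map (x ∷_) (allPts p m)) f)
                             (∑-cong (allFin p) (λ x → ∑-map (allPts p m) (x ∷_) f))

∑-allPts-1 : ∀ p m → ∑[ v ∈ allPts p m ] 1 ≡ p ^ m
∑-allPts-1 p zero    = refl
∑-allPts-1 p (suc m) = begin
  ∑[ v ∈ allPts p (suc m) ] 1           ≡⟨ ∑-allPts-suc {p} m (λ _ → 1) ⟩
  ∑[ x ∈ allFin p ] ∑[ w ∈ allPts p m ] 1 ≡⟨ ∑-cong (allFin p) (λ _ → ∑-allPts-1 p m) ⟩
  ∑[ x ∈ allFin p ] (p ^ m)             ≡⟨ ∑-const (allFin p) (p ^ m) ⟩
  length (allFin p) * p ^ m             ≡⟨ cong (_* p ^ m) (List.length-tabulate {n = p} id) ⟩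
  p * p ^ m                             ∎
  where open ≡-Reasoning

infix 4 _≟ᵛ_
_≟ᵛ_ : ∀ {p m} (u v : Pt p m) → Dec (u ≡ v)
_≟ᵛ_ = ≡-dec _≟_

∑-δᵛ : ∀ {p m} (v₀ : Pt p m) (h : Pt p m → ℕ) → ∑[ v ∈ allPts p m ] (if does (v ≟ᵛ v₀) then h v else 0) ≡ h v₀
∑-δᵛ {p} {zero}  []       h = +-identityʳ (h [])
∑-δᵛ {p} {suc m} (y ∷ w₀) h = begin
  ∑[ v ∈ allPts p (suc m) ] (if does (v ≟ᵛ y ∷ w₀) then h v else 0)
    ≡⟨ ∑-allPts-suc m (λ v → if does (v ≟ᵛ y ∷ w₀) then h v else 0) ⟩
  ∑[ x ∈ allFin p ] ∑[ w ∈ allPts p m ] (if does (x ≟ y) ∧ does (w ≟ᵛ w₀) then h (x ∷ w) else 0)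
    ≡⟨ ∑-cong (allFin p) (λ x → trans (∑-cong (allPts p m) (λ w → if-∧ (does (x ≟ y)) (does (w ≟ᵛ w₀)) (h (x ∷ w))))
                                      (∑-if (allPts p m) (does (x ≟ y)) (λ w → if does (w ≟ᵛ w₀) then h (x ∷ w) else 0))) ⟩
  ∑[ x ∈ allFin p ] (if does (x ≟ y) then ∑[ w ∈ allPts p m ] (if does (w ≟ᵛ w₀) then h (x ∷ w) else 0) else 0)
    ≡⟨ ∑-cong (allFin p) (λ x → cong (λ z → if does (x ≟ y) then z else 0) (∑-δᵛ w₀ (λ w → h (x ∷ w)))) ⟩
  ∑[ x ∈ allFin p ] (if does (x ≟ y) then h (x ∷ w₀) else 0)
    ≡⟨ ∑-δ y (λ x → h (x ∷ w₀)) ⟩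
  h (y ∷ w₀) ∎
  where
  open ≡-Reasoning
  if-∧ : ∀ a b n → (if a ∧ b then n else 0) ≡ (if a then (if b then n else 0) else 0)
  if-∧ true  b n = refl
  if-∧ false b n = refl

card≤ : ∀ {p m} (S : SubsetF p m) → card S ≤ p ^ m
card≤ {p} {m} S = subst (card S ≤_) (∑-allPts-1 p m) (∑-mono-≤ (allPts p m) (𝟙≤1 ∘ S))

card<-if-missing : ∀ {p m} (S : SubsetF p m) (v₀ : Pt p m) → S v₀ ≡ false → card S < p ^ m
card<-if-missing {p} {m} S v₀ v₀∉S = begin-strict
  card S                                                              <⟨ m<m+n (card S) z<s ⟩
  card S + 1                                                          ≡⟨ cong (card S +_) (sym (∑-δᵛ v₀ (λ _ → 1))) ⟩
  card S + (∑[ v ∈ allPts p m ] (if does (v ≟ᵛ v₀) then 1 else 0))    ≡⟨ sym (∑-distrib-+ (allPts p m) _ _) ⟩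
  ∑[ v ∈ allPts p m ] (𝟙 (S v) + (if does (v ≟ᵛ v₀) then 1 else 0))  ≤⟨ ∑-mono-≤ (allPts p m) at-most-one ⟩
  ∑[ v ∈ allPts p m ] 1                                               ≡⟨ ∑-allPts-1 p m ⟩
  p ^ m                                                               ∎
  where
  open ≤-Reasoning
  at-most-one : ∀ v → 𝟙 (S v) + (if does (v ≟ᵛ v₀) then 1 else 0) ≤ 1
  at-most-one v with v ≟ᵛ v₀
  ... | yes refl rewrite v₀∉S = ≤-refl
  ... | no _     = ≤-trans (≤-reflexive (+-identityʳ _)) (𝟙≤1 (S v))

card<-¬full : ∀ {p m} (S : SubsetF p m) → ¬ (∀ v → S v ≡ true) → card S < p ^ m
card<-¬full S ¬full with m≤n⇒m<n∨m≡n (card≤ S)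
... | inj₁ card< = card<
... | inj₂ card≡ = ⊥-elim (¬full full)
  where
  full : ∀ v → S v ≡ true
  full v with S v in v∈S
  ... | true  = refl
  ... | false = ⊥-elim (<⇒≢ (card<-if-missing S v v∈S) card≡)

IsRk⇒≤ : ∀ {p k m R} → IsRk p k m R → R ≤ p ^ m
IsRk⇒≤ ((S , _ , card≡R) , _) = subst (_≤ _) card≡R (card≤ S)

∑≤term+rest : ∀ {q} (f : Fin (suc q) → ℕ) {R} → (∀ s → f s ≤ R) → ∀ t → ∑ (allFin (suc q)) f ≤ f t + q * R
∑≤term+rest {q} f {R} f≤R t = begin
  ∑ Fs f                                                ≡⟨ split-at f ⟩
  f t + ∑ Fs (λ s → if does (s ≟ t) then 0 else f s)    ≤⟨ +-monoʳ-≤ (f t) (∑-mono-≤ Fs rest≤) ⟩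
  f t + ∑ Fs (λ s → if does (s ≟ t) then 0 else R)      ≡⟨ cong (f t +_) rest≡q*R ⟩
  f t + q * R                                           ∎
  where
  open ≤-Reasoning
  Fs = allFin (suc q)
  split-at : (g : Fin (suc q) → ℕ) → ∑ Fs g ≡ g t + ∑ Fs (λ s → if does (s ≟ t) then 0 else g s)
  split-at g = trans (∑-cong Fs (λ s → split (does (s ≟ t)) (g s)))
                     (trans (∑-distrib-+ Fs (λ s → if does (s ≟ t) then g s else 0) (λ s → if does (s ≟ t) then 0 else g s))
                            (cong (_+ ∑ Fs (λ s → if does (s ≟ t) then 0 else g s)) (∑-δ t g)))
    where
    split : ∀ b k → k ≡ (if b then k else 0) + (if b then 0 else k)
    split true  k = sym (+-identityʳ k)
    split false k = refl
  rest≤ : ∀ s → (if does (s ≟ t) then 0 else f s) ≤ (if does (s ≟ t) then 0 else R)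
  rest≤ s with does (s ≟ t)
  ... | true  = z≤n
  ... | false = f≤R s
  rest≡q*R : ∑ Fs (λ s → if does (s ≟ t) then 0 else R) ≡ q * R
  rest≡q*R = +-cancelˡ-≡ R _ _ (begin-equality
    R + ∑ Fs (λ s → if does (s ≟ t) then 0 else R)   ≡⟨ split-at (λ _ → R) ⟨
    ∑[ s ∈ Fs ] R                                     ≡⟨ ∑-const Fs R ⟩
    length Fs * R                                     ≡⟨ cong (_* R) (List.length-tabulate {n = suc q} id) ⟩
    R + q * R                                         ∎)

sandwich : ∀ {m s R} → m ≤ s → s ≤ R → s * s + R * m ≤ (R + m) * s
sandwich {m} m≤s s≤R with m≤n⇒∃[o]m+o≡n m≤s | m≤n⇒∃[o]m+o≡n s≤R
... | a , refl | b , refl = subst ((m + a) * (m + a) + (m + a + b) * m ≤_) (sym (expand m a b)) (m≤m+n _ (a * b))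
  where
  -- (R + m) s − s² − R m = (s − m)(R − s)
  expand : ∀ m a b → (m + a + b + m) * (m + a) ≡ (m + a) * (m + a) + (m + a + b) * m + a * b
  expand = ℕ-solve-∀

∑-squares≤ : (xs : List X) (f : X → ℕ) {m R : ℕ} → (∀ x → m ≤ f x × f x ≤ R) →
             (∑[ x ∈ xs ] f x * f x) + length xs * (R * m) ≤ (R + m) * ∑ xs f
∑-squares≤ xs f {m} {R} bounds = begin
  (∑[ x ∈ xs ] f x * f x) + length xs * (R * m)   ≡⟨ cong ((∑[ x ∈ xs ] f x * f x) +_) (∑-const xs (R * m)) ⟨
  (∑[ x ∈ xs ] f x * f x) + (∑[ x ∈ xs ] R * m)   ≡⟨ ∑-distrib-+ xs _ _ ⟨
  ∑[ x ∈ xs ] (f x * f x + R * m)                 ≤⟨ ∑-mono-≤ xs (λ x → sandwich (proj₁ (bounds x)) (proj₂ (bounds x))) ⟩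
  ∑[ x ∈ xs ] ((R + m) * f x)                     ≡⟨ ∑-*ˡ xs (R + m) f ⟩
  (R + m) * ∑ xs f                                ∎
  where open ≤-Reasoning

^-double : ∀ p n → p ^ (2 * n) ≡ p ^ n * p ^ n
^-double p n = trans (^-distribˡ-+-* p n (n + 0)) (cong (λ k → p ^ n * p ^ k) (+-identityʳ n))

module Congruence (q : ℕ) where

  P : ℕ
  P = suc q

  infix 4 _≈_
  record _≈_ (a b : ℕ) : Set where
    constructor mk≈
    field %-≡ : a % P ≡ b % P
  open _≈_ public

  ≈-setoid : Setoid 0ℓ 0ℓ
  ≈-setoid = record
    { Carrier       = ℕ
    ; _≈_           = _≈_
    ; isEquivalence = record
      { refl  = mk≈ refl
      ; sym   = λ a≈b → mk≈ (sym (%-≡ a≈b))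
      ; trans = λ a≈b b≈c → mk≈ (trans (%-≡ a≈b) (%-≡ b≈c))
      }
    }

  open Setoid ≈-setoid public using () renaming (refl to ≈-refl; sym to ≈-sym; trans to ≈-trans; reflexive to ≈-reflexive)
  module ≈-Reasoning = SetoidReasoning ≈-setoid

  +-cong-≈ : ∀ {a b c d} → a ≈ b → c ≈ d → a + c ≈ b + d
  +-cong-≈ {a} {b} {c} {d} (mk≈ a≈b) (mk≈ c≈d) = mk≈ (begin
    (a + c) % P             ≡⟨ %-distribˡ-+ a c P ⟩
    (a % P + c % P) % P     ≡⟨ cong₂ (λ x y → (x + y) % P) a≈b c≈d ⟩
    (b % P + d % P) % P     ≡⟨ %-distribˡ-+ b d P ⟨
    (b + d) % P             ∎)
    where open ≡-Reasoning

  *-cong-≈ : ∀ {a b c d} → a ≈ b → c ≈ d → a * c ≈ b * d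
  *-cong-≈ {a} {b} {c} {d} (mk≈ a≈b) (mk≈ c≈d) = mk≈ (begin
    (a * c) % P             ≡⟨ %-distribˡ-* a c P ⟩
    (a % P * (c % P)) % P   ≡⟨ cong₂ (λ x y → (x * y) % P) a≈b c≈d ⟩
    (b % P * (d % P)) % P   ≡⟨ %-distribˡ-* b d P ⟨
    (b * d) % P             ∎)
    where open ≡-Reasoning

  %-≈ : ∀ a → a % P ≈ a
  %-≈ a = mk≈ (m%n%n≡m%n a P)

  toℕ-mod-≈ : ∀ a → toℕ (a mod P) ≈ a
  toℕ-mod-≈ a = ≈-trans (≈-reflexive (toℕ-fromℕ< (m%n<n a P))) (%-≈ a)

  +-*P-≈ : ∀ a k → a + k * P ≈ a
  +-*P-≈ a k = mk≈ ([m+kn]%n≡m%n a k P)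

  *P-≈0 : ∀ k → k * P ≈ 0
  *P-≈0 k = +-*P-≈ 0 k

  ≈⇒≡ : ∀ {a b} → a < P → b < P → a ≈ b → a ≡ b
  ≈⇒≡ a<P b<P (mk≈ a≈b) = trans (sym (m<n⇒m%n≡m a<P)) (trans a≈b (m<n⇒m%n≡m b<P))

  ≡-mod⇔≈ : (x : Fin P) (a : ℕ) → (x ≡ a mod P) ⇔ (toℕ x ≈ a)
  ≡-mod⇔≈ x a = mk⇔ (λ { refl → toℕ-mod-≈ a })
    (λ x≈a → toℕ-injective (≈⇒≡ (toℕ<n x) (toℕ<n (a mod P)) (≈-trans x≈a (≈-sym (toℕ-mod-≈ a)))))

  mod-≡⇔≈ : ∀ a b → (a mod P ≡ b mod P) ⇔ (a ≈ b)
  mod-≡⇔≈ a b = mk⇔ (≈-trans (≈-sym (toℕ-mod-≈ a)) ∘ Equivalence.to (≡-mod⇔≈ (a mod P) b))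
                    (Equivalence.from (≡-mod⇔≈ (a mod P) b) ∘ ≈-trans (toℕ-mod-≈ a))

  +-cancelʳ-≈ : ∀ a b c → a + c ≈ b + c → a ≈ b
  +-cancelʳ-≈ a b c a+c≈b+c = begin
    a                  ≈⟨ +-*P-≈ a c ⟨
    a + c * P          ≡⟨ shift a c q ⟩
    a + c + c * q      ≈⟨ +-cong-≈ a+c≈b+c (≈-refl {c * q}) ⟩
    b + c + c * q      ≡⟨ shift b c q ⟨
    b + c * P          ≈⟨ +-*P-≈ b c ⟩
    b                  ∎
    where
    open ≈-Reasoning
    shift : ∀ x c q → x + c * suc q ≡ x + c + c * q
    shift = ℕ-solve-∀

  -- q plays the role of -1
  +q*≈0⇔≈ : ∀ a b → (a + q * b ≈ 0) ⇔ (a ≈ b)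
  +q*≈0⇔≈ a b = mk⇔
    (λ a-b≈0 → +-cancelʳ-≈ a b (q * b) (≈-trans a-b≈0 (≈-sym (b+q*b≈0))))
    (λ a≈b → ≈-trans (+-cong-≈ a≈b (≈-refl {q * b})) b+q*b≈0)
    where
    b+q*b≈0 : b + q * b ≈ 0
    b+q*b≈0 = ≈-trans (≈-reflexive (*-comm P b)) (*P-≈0 b)

  inverse : Prime P → (c : ℕ) → .{{NonZero c}} → c < P → ∃ λ c⁻¹ → c * c⁻¹ ≈ 1
  inverse P-prime c c<P with coprime-Bézout (Coprime.sym (prime⇒coprime P-prime c<P))
  ... | Bézout.+- x y 1+yP≡xc = x , ≈-trans (≈-reflexive (trans (*-comm c x) (sym 1+yP≡xc))) (+-*P-≈ 1 y)
  ... | Bézout.-+ x y 1+xc≡yP = q * x , (begin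
    c * (q * x)        ≡⟨ rearrange c q x ⟩
    q * (x * c)        ≈⟨ +-cancelʳ-≈ (q * (x * c)) 1 (x * c) -xc+xc≈1+xc ⟩
    1                  ∎)
    where
    open ≈-Reasoning
    rearrange : ∀ c q x → c * (q * x) ≡ q * (x * c)
    rearrange = ℕ-solve-∀
    -xc+xc≈1+xc : q * (x * c) + x * c ≈ 1 + x * c
    -xc+xc≈1+xc = begin
      q * (x * c) + x * c   ≡⟨ +-comm (q * (x * c)) (x * c) ⟩
      P * (x * c)           ≈⟨ ≈-reflexive (*-comm P (x * c)) ⟩
      x * c * P             ≈⟨ *P-≈0 (x * c) ⟩
      0                     ≈⟨ *P-≈0 y ⟨
      y * P                 ≡⟨ 1+xc≡yP ⟨
      1 + x * c             ∎

  solve-linear : ∀ {c c⁻¹} → c * c⁻¹ ≈ 1 → ∀ T X D → (T ≈ c * X + D) ⇔ (X ≈ c⁻¹ * (T + q * D))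
  solve-linear {c} {c⁻¹} cc⁻¹≈1 T X D = mk⇔ to from
    where
    open ≈-Reasoning
    to : T ≈ c * X + D → X ≈ c⁻¹ * (T + q * D)
    to T≈cX+D = begin
      X                               ≡⟨ *-identityˡ X ⟨
      1 * X                           ≈⟨ *-cong-≈ (≈-sym cc⁻¹≈1) (≈-refl {X}) ⟩
      c * c⁻¹ * X                     ≈⟨ +-*P-≈ (c * c⁻¹ * X) (c⁻¹ * D) ⟨
      c * c⁻¹ * X + c⁻¹ * D * P       ≡⟨ expand c c⁻¹ X D q ⟩
      c⁻¹ * (c * X + D + q * D)       ≈⟨ *-cong-≈ (≈-refl {c⁻¹}) (+-cong-≈ (≈-sym T≈cX+D) (≈-refl {q * D})) ⟩
      c⁻¹ * (T + q * D)               ∎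
      where
      expand : ∀ c c⁻¹ X D q → c * c⁻¹ * X + c⁻¹ * D * suc q ≡ c⁻¹ * (c * X + D + q * D)
      expand = ℕ-solve-∀
    from : X ≈ c⁻¹ * (T + q * D) → T ≈ c * X + D
    from X≈ = ≈-sym (begin
      c * X + D                       ≈⟨ +-cong-≈ (*-cong-≈ (≈-refl {c}) X≈) (≈-refl {D}) ⟩
      c * (c⁻¹ * (T + q * D)) + D     ≡⟨ cong (_+ D) (*-assoc c c⁻¹ (T + q * D)) ⟨
      c * c⁻¹ * (T + q * D) + D       ≈⟨ +-cong-≈ (*-cong-≈ cc⁻¹≈1 (≈-refl {T + q * D})) (≈-refl {D}) ⟩
      1 * (T + q * D) + D             ≡⟨ collect T D q ⟩
      T + D * P                       ≈⟨ +-*P-≈ T D ⟩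
      T                               ∎)
      where
      collect : ∀ T D q → 1 * (T + q * D) + D ≡ T + D * suc q
      collect = ℕ-solve-∀

-- x = |S|, N = pⁿ, Z = pⁿ⁺¹ − 1, W = Σ_{c ≠ 0} Σ_t |S ∩ {c · v = t}|², and every section has size in [m, R].
module QuadraticBound where

  open IntegerIdentities
  open import Data.Integer.Base as ℤ using (+_; +≤+)
  import Data.Integer.Properties as ℤ

  quadratic-nonneg : ∀ q x R m N Z W → 1 ≤ q → Z + 1 ≡ suc q * N →
                     W + x * x ≡ N * (x * x) + q * N * x →
                     W + Z * (suc q * (R * m)) ≤ Z * ((R + m) * x) →
                     x ≤ m + q * R → m ≤ R →
                     (2 * Z * R + N) * x ≤ N * x * x + suc q * Z * R * R
  quadratic-nonneg q@(suc _) x R m N Z W _ hZ hW hsum x≤m+qR m≤R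
    with m≤n⇒∃[o]m+o≡n hsum | m≤n⇒∃[o]m+o≡n x≤m+qR | m≤n⇒∃[o]m+o≡n m≤R
  ... | g , hg | e , he | f , hf =
    uncast-≤ ((‵ 2 ‵* ‵ Z ‵* ‵ R ‵+ ‵ N) ‵* ‵ x) (‵ N ‵* ‵ x ‵* ‵ x ‵+ ‵ suc q ‵* ‵ Z ‵* ‵ R ‵* ‵ R)
      (ℤ.0≤i-j⇒j≤i (ℤ.*-cancelˡ-≤-pos (+ 0) (T (+ N) (+ Z) (+ q) (+ R) (+ x)) (+ q) 0≤qT))
    where
    slack = ‵ g ‵+ ‵ e ‵* ‵ Z ‵* (‵ e ‵+ ‵ f)
    qT≡slack : + q ℤ.* T (+ N) (+ Z) (+ q) (+ R) (+ x) ≡ ⟦ slack ⟧ℤ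
    qT≡slack = Q*T≡ (+ x) (+ R) (+ m) (+ N) (+ q) (+ W) (+ Z) (+ g) (+ e) (+ f)
      (cast (‵ W ‵+ ‵ Z ‵* (‵ suc q ‵* (‵ R ‵* ‵ m)) ‵+ ‵ g) (‵ Z ‵* ((‵ R ‵+ ‵ m) ‵* ‵ x)) hg)
      (cast (‵ W ‵+ ‵ x ‵* ‵ x) (‵ N ‵* (‵ x ‵* ‵ x) ‵+ ‵ q ‵* ‵ N ‵* ‵ x) hW)
      (cast (‵ Z ‵+ ‵ 1) (‵ suc q ‵* ‵ N) hZ)
      (cast (‵ x ‵+ ‵ e) (‵ m ‵+ ‵ q ‵* ‵ R) he)
      (cast (‵ m ‵+ ‵ f) (‵ R) hf)
    0≤qT : + q ℤ.* + 0 ℤ.≤ + q ℤ.* T (+ N) (+ Z) (+ q) (+ R) (+ x)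
    0≤qT = subst₂ ℤ._≤_ (sym (ℤ.*-zeroʳ (+ q))) (trans +⟦ slack ⟧ℕ (sym qT≡slack)) (+≤+ z≤n)

  below-vertex : ∀ q x R N Z t → Z + 1 ≡ suc q * N →
                 (2 * Z * R + N) * x + t ≡ N * x * x + suc q * Z * R * R →
                 x ≤ suc q * R → R ≤ N → x < suc q * N → 2 * N * x ≤ 2 * Z * R + N
  below-vertex q x R N Z t hZ ht x≤PR R≤N x<PN with 2 * N * x ≤? 2 * Z * R + N
  ... | yes below = below
  ... | no ¬below with m≤n⇒∃[o]m+o≡n (≰⇒> ¬below) | m≤n⇒∃[o]m+o≡n x≤PR | m≤n⇒∃[o]m+o≡n R≤N
  ... | u , hu | w , hw | h , hh = ⊥-elim ([ PR≢0 , h≢0 ]′ (m*n≡0⇒m≡0∨n≡0 (suc q * R) PRh≡0))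
    where
    -- T(x) ≥ 0 ≥ T(PR) = −PR(N − R); past the vertex T is increasing, so everything must vanish.
    sum≡0 : t + suc q * R * h + w * (1 + u + N * w) ≡ 0
    sum≡0 = uncast (‵ t ‵+ ‵ suc q ‵* ‵ R ‵* ‵ h ‵+ ‵ w ‵* (‵ 1 ‵+ ‵ u ‵+ ‵ N ‵* ‵ w)) (‵ 0)
      (T+…≡0 (+ x) (+ R) (+ N) (+ q) (+ Z) (+ h) (+ w) (+ u) (+ t)
        (cast (‵ Z ‵+ ‵ 1) (‵ suc q ‵* ‵ N) hZ)
        (cast (‵ R ‵+ ‵ h) (‵ N) hh)
        (cast (‵ x ‵+ ‵ w) (‵ suc q ‵* ‵ R) hw)
        (cast (‵ 1 ‵+ (‵ 2 ‵* ‵ Z ‵* ‵ R ‵+ ‵ N) ‵+ ‵ u) (‵ 2 ‵* ‵ N ‵* ‵ x) hu)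
        (cast ((‵ 2 ‵* ‵ Z ‵* ‵ R ‵+ ‵ N) ‵* ‵ x ‵+ ‵ t) (‵ N ‵* ‵ x ‵* ‵ x ‵+ ‵ suc q ‵* ‵ Z ‵* ‵ R ‵* ‵ R) ht))
    PRh≡0 : suc q * R * h ≡ 0
    PRh≡0 = m+n≡0⇒n≡0 t (m+n≡0⇒m≡0 (t + suc q * R * h) sum≡0)
    x≡PR : x ≡ suc q * R
    x≡PR = begin
      x                       ≡⟨ +-identityʳ x ⟨
      x + 0                   ≡⟨ cong (λ y → x + y) w≡0 ⟨
      x + w                   ≡⟨ hw ⟩
      suc q * R               ∎
      where
      open ≡-Reasoning
      w≡0 : w ≡ 0
      w≡0 with m*n≡0⇒m≡0∨n≡0 w (m+n≡0⇒n≡0 (t + suc q * R * h) sum≡0)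
      ... | inj₁ w≡0 = w≡0
    PR≢0 : suc q * R ≢ 0
    PR≢0 PR≡0 = 1+n≢0 (trans hu (trans (cong (2 * N *_) (trans x≡PR PR≡0)) (*-zeroʳ (2 * N))))
    h≢0 : h ≢ 0
    h≢0 h≡0 = <-irrefl (trans x≡PR (cong (suc q *_) R≡N)) x<PN
      where
      R≡N : R ≡ N
      R≡N = trans (sym (+-identityʳ R)) (trans (cong (λ y → R + y) (sym h≡0)) hh)

  discriminant-bound : ∀ q x R N Z t → Z + 1 ≡ suc q * N →
                       (2 * Z * R + N) * x + t ≡ N * x * x + suc q * Z * R * R →
                       R ≤ N → 2 * N * x ≤ 2 * Z * R + N →
                       4 * Z * R * (N ∸ R) + N * N ≤ (2 * Z * R + N ∸ 2 * N * x) * (2 * Z * R + N ∸ 2 * N * x)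
  discriminant-bound q x R N Z t hZ ht R≤N below with m≤n⇒∃[o]m+o≡n R≤N | m≤n⇒∃[o]m+o≡n below
  ... | h , hh | d , hd = begin
    4 * Z * R * (N ∸ R) + N * N              ≡⟨ cong (λ y → 4 * Z * R * y + N * N) N∸R≡h ⟩
    4 * Z * R * h + N * N                    ≤⟨ m≤m+n _ (4 * N * t) ⟩
    4 * Z * R * h + N * N + 4 * N * t        ≡⟨ d*d≡ ⟨
    d * d                                    ≡⟨ cong (λ y → y * y) A∸2Nx≡d ⟨
    (A ∸ 2 * N * x) * (A ∸ 2 * N * x)        ∎
    where
    open ≤-Reasoning
    A = 2 * Z * R + N
    N∸R≡h : N ∸ R ≡ h
    N∸R≡h = trans (cong (_∸ R) (sym hh)) (m+n∸m≡n R h)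
    A∸2Nx≡d : A ∸ 2 * N * x ≡ d
    A∸2Nx≡d = trans (cong (_∸ 2 * N * x) (sym hd)) (m+n∸m≡n (2 * N * x) d)
    d*d≡ : d * d ≡ 4 * Z * R * h + N * N + 4 * N * t
    d*d≡ = uncast (‵ d ‵* ‵ d) (‵ 4 ‵* ‵ Z ‵* ‵ R ‵* ‵ h ‵+ ‵ N ‵* ‵ N ‵+ ‵ 4 ‵* ‵ N ‵* ‵ t)
      (D*D≡ (+ x) (+ R) (+ N) (+ q) (+ Z) (+ h) (+ d) (+ t)
        (cast (‵ Z ‵+ ‵ 1) (‵ suc q ‵* ‵ N) hZ)
        (cast (‵ R ‵+ ‵ h) (‵ N) hh)
        (cast (‵ 2 ‵* ‵ N ‵* ‵ x ‵+ ‵ d) (‵ 2 ‵* ‵ Z ‵* ‵ R ‵+ ‵ N) hd)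
        (cast ((‵ 2 ‵* ‵ Z ‵* ‵ R ‵+ ‵ N) ‵* ‵ x ‵+ ‵ t) (‵ N ‵* ‵ x ‵* ‵ x ‵+ ‵ suc q ‵* ‵ Z ‵* ‵ R ‵* ‵ R) ht))

  quadratic-bound : ∀ q x R m N Z W → 1 ≤ q → Z + 1 ≡ suc q * N →
                    W + x * x ≡ N * (x * x) + q * N * x →
                    W + Z * (suc q * (R * m)) ≤ Z * ((R + m) * x) →
                    x ≤ m + q * R → m ≤ R → R ≤ N → x < suc q * N →
                    LeqMinusSqrtOver x (2 * Z * R + N) (4 * Z * R * (N ∸ R) + N * N) (2 * N)
  quadratic-bound q x R m N Z W 1≤q hZ hW hsum x≤m+qR m≤R R≤N x<PN
    with m≤n⇒∃[o]m+o≡n (quadratic-nonneg q x R m N Z W 1≤q hZ hW hsum x≤m+qR m≤R)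
  ... | t , ht = below , discriminant-bound q x R N Z t hZ ht R≤N below
    where
    below = below-vertex q x R N Z t hZ ht (≤-trans x≤m+qR (+-monoˡ-≤ (q * R) m≤R)) R≤N x<PN

module Geometry (q : ℕ) (P-prime : Prime (suc q)) where

  open Congruence q
  open QuadraticBound using (quadratic-bound)

  𝟎 : ∀ {m} → Pt P m
  𝟎 = replicate _ zero

  ≡𝟎⇔all-zero : ∀ {m} (b : Pt P m) → (b ≡ 𝟎) ⇔ ((j : Fin m) → toℕ (lookup b j) ≡ 0)
  ≡𝟎⇔all-zero b = mk⇔ (λ { refl j → cong toℕ (lookup-replicate j zero) }) (all-zero⇒≡𝟎 b)
    where
    all-zero⇒≡𝟎 : ∀ {m} (b : Pt P m) → ((j : Fin m) → toℕ (lookup b j) ≡ 0) → b ≡ 𝟎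
    all-zero⇒≡𝟎 []      _ = refl
    all-zero⇒≡𝟎 (x ∷ b) z = cong₂ _∷_ (toℕ-injective (z zero)) (all-zero⇒≡𝟎 b (z ∘ suc))

  ≢𝟎⇔NonZeroVec : ∀ {m} (b : Pt P m) → (b ≢ 𝟎) ⇔ NonZeroVec b
  ≢𝟎⇔NonZeroVec b = mk⇔ (λ b≢𝟎 → b≢𝟎 ∘ Equivalence.from (≡𝟎⇔all-zero b))
                          (λ nz → nz ∘ Equivalence.to (≡𝟎⇔all-zero b))

  1≤q : 1 ≤ q
  1≤q = s≤s⁻¹ (nonTrivial⇒n>1 P ⦃ prime⇒nonTrivial P-prime ⦄)

  e₁ : ∀ {m} → Pt P (suc m)
  e₁ = fromℕ< (s≤s 1≤q) ∷ 𝟎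

  e₁≢𝟎 : ∀ {m} → e₁ {m} ≢ 𝟎
  e₁≢𝟎 e₁≡𝟎 = 1+n≢0 (trans (sym (toℕ-fromℕ< (s≤s 1≤q))) (cong toℕ (proj₁ (∷-injective e₁≡𝟎))))

  toℕ-⊕⊙-≈ : (i : ℕ) (a b : Fin P) → toℕ (addF a (smulF i b)) ≈ toℕ a + i * toℕ b
  toℕ-⊕⊙-≈ i a b = ≈-trans (toℕ-mod-≈ (toℕ a + toℕ (smulF i b))) (+-cong-≈ (≈-refl {toℕ a}) (toℕ-mod-≈ (i * toℕ b)))

  -- Computed on representatives in ℕ and only ever used modulo P.
  dot : ∀ {m} → Pt P m → Pt P m → ℕ
  dot []       []       = 0
  dot (a ∷ as) (b ∷ bs) = toℕ a * toℕ b + dot as bs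

  dot-comm : ∀ {m} (u v : Pt P m) → dot u v ≡ dot v u
  dot-comm []      []      = refl
  dot-comm (a ∷ u) (b ∷ v) = cong₂ _+_ (*-comm (toℕ a) (toℕ b)) (dot-comm u v)

  dot-𝟎ˡ : ∀ {m} (u : Pt P m) → dot 𝟎 u ≡ 0
  dot-𝟎ˡ []      = refl
  dot-𝟎ˡ (x ∷ u) = dot-𝟎ˡ u

  dot-affine : ∀ {m} (c a b : Pt P m) (i : ℕ) → dot c (a ⊕ (i ⊙ b)) ≈ dot c a + i * dot c b
  dot-affine []        []        []        i = ≈-reflexive (sym (*-zeroʳ i))
  dot-affine (c₀ ∷ c) (a₀ ∷ a) (b₀ ∷ b) i =
    ≈-trans (+-cong-≈ (*-cong-≈ (≈-refl {toℕ c₀}) (toℕ-⊕⊙-≈ i a₀ b₀)) (dot-affine c a b i))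
            (≈-reflexive (regroup (toℕ c₀) (toℕ a₀) (toℕ b₀) i (dot c a) (dot c b)))
    where
    regroup : ∀ c₀ a₀ b₀ i x y → c₀ * (a₀ + i * b₀) + (x + i * y) ≡ c₀ * a₀ + x + i * (c₀ * b₀ + y)
    regroup = ℕ-solve-∀

  onHyperplane : ∀ {m} → Pt P m → Fin P → Pt P m → Bool
  onHyperplane c t v = does (t ≟ dot c v mod P)

  -- ∑-hyperplane says that φ maps 𝔽ₚⁿ bijectively onto the hyperplane c · v = t.
  record Parametrisation {n} (c : Pt P (suc n)) (t : Fin P) : Set where
    field
      φ ψ          : Pt P n → Pt P (suc n)
      ∑-hyperplane : (f : Pt P (suc n) → ℕ) →
                     ∑[ v ∈ allPts P (suc n) ] (if onHyperplane c t v then f v else 0) ≡ ∑[ w ∈ allPts P n ] f (φ w)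
      φ-affine     : ∀ i a b → φ (a ⊕ (i ⊙ b)) ≡ φ a ⊕ (i ⊙ ψ b)
      ψ-≢𝟎         : ∀ b → b ≢ 𝟎 → ψ b ≢ 𝟎

  module _ {n} (c′ : Pt P (suc n)) (t : Fin P) (par : Parametrisation c′ t) where
    open Parametrisation par

    private
      φ′ ψ′ : Pt P (suc n) → Pt P (2 + n)
      φ′ (x ∷ w) = x ∷ φ w
      ψ′ (x ∷ w) = x ∷ ψ w

    parametrise-zero∷ : Parametrisation (zero ∷ c′) t
    parametrise-zero∷ = record
      { φ            = φ′
      ; ψ            = ψ′
      ; ∑-hyperplane = λ f → begin
          ∑[ v ∈ allPts P (2 + n) ] (if onHyperplane (zero ∷ c′) t v then f v else 0)
            ≡⟨ ∑-allPts-suc (suc n) (λ v → if onHyperplane (zero ∷ c′) t v then f v else 0) ⟩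
          ∑[ x ∈ allFin P ] ∑[ v ∈ allPts P (suc n) ] (if onHyperplane c′ t v then f (x ∷ v) else 0)
            ≡⟨ ∑-cong (allFin P) (λ x → ∑-hyperplane (λ v → f (x ∷ v))) ⟩
          ∑[ x ∈ allFin P ] ∑[ w ∈ allPts P n ] f (x ∷ φ w)
            ≡⟨ ∑-allPts-suc n (f ∘ φ′) ⟨
          ∑[ w ∈ allPts P (suc n) ] f (φ′ w) ∎
      ; φ-affine     = λ { i (a₀ ∷ a) (b₀ ∷ b) → cong (addF a₀ (smulF i b₀) ∷_) (φ-affine i a b) }
      ; ψ-≢𝟎         = λ { (b₀ ∷ b) b≢𝟎 ψ′b≡𝟎 → let (b₀≡0 , ψb≡𝟎) = ∷-injective ψ′b≡𝟎 in
                           ψ-≢𝟎 b (λ b≡𝟎 → b≢𝟎 (cong₂ _∷_ b₀≡0 b≡𝟎)) ψb≡𝟎 }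
      }
      where open ≡-Reasoning

  module _ {n} (c₀ : Fin P) (c₀≢0 : c₀ ≢ zero) (c′ : Pt P n) (t : Fin P) where
    private
      instance
        c₀-nonZero : NonZero (toℕ c₀)
        c₀-nonZero = ≢-nonZero (c₀≢0 ∘ toℕ-injective)

      c₀⁻¹ : ℕ
      c₀⁻¹ = proj₁ (inverse P-prime (toℕ c₀) (toℕ<n c₀))

      c₀c₀⁻¹≈1 : toℕ c₀ * c₀⁻¹ ≈ 1
      c₀c₀⁻¹≈1 = proj₂ (inverse P-prime (toℕ c₀) (toℕ<n c₀))

      -- The unique x with c₀ x + D = s, namely c₀⁻¹ (s − D).
      solution : Fin P → ℕ → Fin P
      solution s D = (c₀⁻¹ * (toℕ s + q * D)) mod P

      φ′ ψ′ : Pt P n → Pt P (suc n)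
      φ′ w = solution t (dot c′ w) ∷ w
      ψ′ w = solution zero (dot c′ w) ∷ w

      onHyperplane-∷ : ∀ x w → onHyperplane (c₀ ∷ c′) t (x ∷ w) ≡ does (x ≟ solution t (dot c′ w))
      onHyperplane-∷ x w = does-⇔ (begin
        t ≡ (toℕ c₀ * toℕ x + D) mod P   ≈⟨ ≡-mod⇔≈ t _ ⟩
        toℕ t ≈ toℕ c₀ * toℕ x + D        ≈⟨ solve-linear {toℕ c₀} {c₀⁻¹} c₀c₀⁻¹≈1 (toℕ t) (toℕ x) D ⟩
        toℕ x ≈ c₀⁻¹ * (toℕ t + q * D)    ≈⟨ ≡-mod⇔≈ x _ ⟨
        x ≡ solution t D                  ∎) (t ≟ _) (x ≟ _)
        where
        D = dot c′ w
        open SetoidReasoning (⇔-setoid 0ℓ)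

      solution-affine : ∀ i a b → solution t (dot c′ (a ⊕ (i ⊙ b)))
                                  ≡ addF (solution t (dot c′ a)) (smulF i (solution zero (dot c′ b)))
      solution-affine i a b = toℕ-injective (≈⇒≡ (toℕ<n _) (toℕ<n _) (begin
        toℕ (solution t (dot c′ (a ⊕ (i ⊙ b))))
          ≈⟨ toℕ-mod-≈ _ ⟩
        c₀⁻¹ * (toℕ t + q * dot c′ (a ⊕ (i ⊙ b)))
          ≈⟨ *-cong-≈ (≈-refl {c₀⁻¹}) (+-cong-≈ (≈-refl {toℕ t}) (*-cong-≈ (≈-refl {q}) (dot-affine c′ a b i))) ⟩
        c₀⁻¹ * (toℕ t + q * (c·a + i * c·b))
          ≡⟨ distribute c₀⁻¹ (toℕ t) q c·a c·b i ⟩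
        c₀⁻¹ * (toℕ t + q * c·a) + i * (c₀⁻¹ * (q * c·b))
          ≈⟨ +-cong-≈ (toℕ-mod-≈ _) (*-cong-≈ (≈-refl {i}) (toℕ-mod-≈ _)) ⟨
        toℕ (solution t c·a) + i * toℕ (solution zero c·b)
          ≈⟨ toℕ-⊕⊙-≈ i (solution t c·a) (solution zero c·b) ⟨
        toℕ (addF (solution t c·a) (smulF i (solution zero c·b))) ∎))
        where
        c·a = dot c′ a
        c·b = dot c′ b
        open ≈-Reasoning
        distribute : ∀ c⁻¹ t q c·a c·b i → c⁻¹ * (t + q * (c·a + i * c·b)) ≡ c⁻¹ * (t + q * c·a) + i * (c⁻¹ * (q * c·b))
        distribute = ℕ-solve-∀

    parametrise-nonzero∷ : Parametrisation (c₀ ∷ c′) t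
    parametrise-nonzero∷ = record
      { φ            = φ′
      ; ψ            = ψ′
      ; ∑-hyperplane = λ f → begin
          ∑[ v ∈ allPts P (suc n) ] (if onHyperplane (c₀ ∷ c′) t v then f v else 0)
            ≡⟨ ∑-allPts-suc n (λ v → if onHyperplane (c₀ ∷ c′) t v then f v else 0) ⟩
          ∑[ x ∈ allFin P ] ∑[ w ∈ allPts P n ] (if onHyperplane (c₀ ∷ c′) t (x ∷ w) then f (x ∷ w) else 0)
            ≡⟨ ∑-cong (allFin P) (λ x → ∑-cong (allPts P n) (λ w →
                 cong (λ b → if b then f (x ∷ w) else 0) (onHyperplane-∷ x w))) ⟩
          ∑[ x ∈ allFin P ] ∑[ w ∈ allPts P n ] (if does (x ≟ solution t (dot c′ w)) then f (x ∷ w) else 0)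
            ≡⟨ ∑-comm (allFin P) (allPts P n) _ ⟩
          ∑[ w ∈ allPts P n ] ∑[ x ∈ allFin P ] (if does (x ≟ solution t (dot c′ w)) then f (x ∷ w) else 0)
            ≡⟨ ∑-cong (allPts P n) (λ w → ∑-δ (solution t (dot c′ w)) (λ x → f (x ∷ w))) ⟩
          ∑[ w ∈ allPts P n ] f (φ′ w) ∎
      ; φ-affine     = λ i a b → cong (_∷ a ⊕ (i ⊙ b)) (solution-affine i a b)
      ; ψ-≢𝟎         = λ b b≢𝟎 ψ′b≡𝟎 → b≢𝟎 (proj₂ (∷-injective ψ′b≡𝟎))
      }
      where open ≡-Reasoning

  parametrise : ∀ {n} (c : Pt P (suc n)) → c ≢ 𝟎 → (t : Fin P) → Parametrisation c t
  parametrise (c₀ ∷ c′) c≢𝟎 t with c₀ ≟ zero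
  parametrise {zero}  (c₀ ∷ []) c≢𝟎 t | yes refl = ⊥-elim (c≢𝟎 refl)
  parametrise {suc n} (c₀ ∷ c′) c≢𝟎 t | yes refl = parametrise-zero∷ c′ t (parametrise c′ (c≢𝟎 ∘ cong (zero ∷_)) t)
  parametrise (c₀ ∷ c′) c≢𝟎 t | no c₀≢0 = parametrise-nonzero∷ c₀ c₀≢0 c′ t

  section : ∀ {m} → SubsetF P m → Pt P m → Fin P → ℕ
  section {m} S c t = ∑[ v ∈ allPts P m ] (if onHyperplane c t v then 𝟙 (S v) else 0)

  progressionFree-∘ : ∀ {n k} {c : Pt P (suc n)} {t} (par : Parametrisation c t) (S : SubsetF P (suc n)) →
                      ProgFree k S → ProgFree k (S ∘ Parametrisation.φ par)
  progressionFree-∘ par S S-free (a , b , b-nonzero , a+ib∈S∘φ) =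
    S-free (φ a , ψ b , Equivalence.to (≢𝟎⇔NonZeroVec (ψ b)) (ψ-≢𝟎 b (Equivalence.from (≢𝟎⇔NonZeroVec b) b-nonzero)) ,
            λ i i<k → trans (cong S (sym (φ-affine i a b))) (a+ib∈S∘φ i i<k))
    where open Parametrisation par

  section≤r : ∀ {n k R} → IsRk P k n R → (S : SubsetF P (suc n)) → ProgFree k S →
              (c : Pt P (suc n)) → c ≢ 𝟎 → ∀ t → section S c t ≤ R
  section≤r {R = R} (_ , maximal) S S-free c c≢𝟎 t =
    subst (_≤ R) (sym (∑-hyperplane (𝟙 ∘ S))) (maximal (S ∘ φ) (progressionFree-∘ par S S-free))
    where
    par = parametrise c c≢𝟎 t
    open Parametrisation par

  ∑-section : ∀ {m} (S : SubsetF P m) (c : Pt P m) → ∑ (allFin P) (section S c) ≡ card S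
  ∑-section {m} S c = trans (∑-comm (allFin P) (allPts P m) _)
                            (∑-cong (allPts P m) (λ v → ∑-δ (dot c v mod P) (λ _ → 𝟙 (S v))))

  section≥ : ∀ {m} (S : SubsetF P m) (c : Pt P m) {R} → (∀ t → section S c t ≤ R) →
             ∀ t → card S ∸ q * R ≤ section S c t
  section≥ S c {R} section≤R t = m≤n+o⇒m∸n≤o (card S) (q * R) (begin
    card S                        ≡⟨ ∑-section S c ⟨
    ∑ (allFin P) (section S c)    ≤⟨ ∑≤term+rest (section S c) section≤R t ⟩
    section S c t + q * R         ≡⟨ +-comm (section S c t) (q * R) ⟩
    q * R + section S c t         ∎)
    where open ≤-Reasoning

  ∑-section²≤ : ∀ {m} (S : SubsetF P m) (c : Pt P m) {ℓ R} → (∀ t → ℓ ≤ section S c t × section S c t ≤ R) →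
                (∑[ t ∈ allFin P ] section S c t * section S c t) + P * (R * ℓ) ≤ (R + ℓ) * card S
  ∑-section²≤ S c {ℓ} {R} bounds =
    subst₂ (λ l r → (∑[ t ∈ allFin P ] section S c t * section S c t) + l * (R * ℓ) ≤ (R + ℓ) * r)
      (List.length-tabulate {n = P} id) (∑-section S c) (∑-squares≤ (allFin P) (section S c) bounds)

  agree : ∀ {m} → Pt P m → Pt P m → Pt P m → Bool
  agree c u v = does (dot c u mod P ≟ dot c v mod P)

  ∑-section² : ∀ {m} (S : SubsetF P m) (c : Pt P m) →
               ∑[ t ∈ allFin P ] (section S c t * section S c t)
               ≡ ∑[ u ∈ allPts P m ] ∑[ v ∈ allPts P m ] (if agree c u v then 𝟙 (S u) * 𝟙 (S v) else 0)
  ∑-section² {m} S c = begin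
    ∑[ t ∈ allFin P ] (section S c t * section S c t)
      ≡⟨ ∑-cong (allFin P) (λ t → ∑-square Ps (f t)) ⟩
    ∑[ t ∈ allFin P ] ∑[ u ∈ Ps ] ∑[ v ∈ Ps ] (f t u * f t v)
      ≡⟨ ∑-comm (allFin P) Ps _ ⟩
    ∑[ u ∈ Ps ] ∑[ t ∈ allFin P ] ∑[ v ∈ Ps ] (f t u * f t v)
      ≡⟨ ∑-cong Ps (λ u → ∑-comm (allFin P) Ps _) ⟩
    ∑[ u ∈ Ps ] ∑[ v ∈ Ps ] ∑[ t ∈ allFin P ] (f t u * f t v)
      ≡⟨ ∑-cong Ps (λ u → ∑-cong Ps (λ v → ∑-cong (allFin P) (λ t → if-* (onHyperplane c t u) (𝟙 (S u)) (f t v)))) ⟩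
    ∑[ u ∈ Ps ] ∑[ v ∈ Ps ] ∑[ t ∈ allFin P ] (if onHyperplane c t u then 𝟙 (S u) * f t v else 0)
      ≡⟨ ∑-cong Ps (λ u → ∑-cong Ps (λ v → ∑-δ (dot c u mod P) (λ t → 𝟙 (S u) * f t v))) ⟩
    ∑[ u ∈ Ps ] ∑[ v ∈ Ps ] (𝟙 (S u) * f (dot c u mod P) v)
      ≡⟨ ∑-cong Ps (λ u → ∑-cong Ps (λ v → *-if (agree c u v) (𝟙 (S u)) (𝟙 (S v)))) ⟩
    ∑[ u ∈ Ps ] ∑[ v ∈ Ps ] (if agree c u v then 𝟙 (S u) * 𝟙 (S v) else 0) ∎
    where
    open ≡-Reasoning
    Ps = allPts P m
    f : Fin P → Pt P m → ℕ
    f t v = if onHyperplane c t v then 𝟙 (S v) else 0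
    if-* : ∀ b x y → (if b then x else 0) * y ≡ (if b then x * y else 0)
    if-* true  x y = refl
    if-* false x y = refl
    *-if : ∀ b x y → x * (if b then y else 0) ≡ (if b then x * y else 0)
    *-if true  x y = refl
    *-if false x y = *-zeroʳ x

  agree≡onHyperplane : ∀ {m} (c u v : Pt P m) → agree c u v ≡ onHyperplane (v ⊕ (q ⊙ u)) zero c
  agree≡onHyperplane c u v = does-⇔ (begin
    dot c u mod P ≡ dot c v mod P     ≈⟨ mod-≡⇔≈ (dot c u) (dot c v) ⟩
    dot c u ≈ dot c v                 ≈⟨ mk⇔ ≈-sym ≈-sym ⟩
    dot c v ≈ dot c u                 ≈⟨ +q*≈0⇔≈ (dot c v) (dot c u) ⟨
    dot c v + q * dot c u ≈ 0         ≈⟨ mk⇔ (λ h → ≈-sym (≈-trans d·c≈ h)) (λ h → ≈-trans (≈-sym d·c≈) (≈-sym h)) ⟩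
    0 ≈ dot d c                       ≈⟨ ≡-mod⇔≈ zero (dot d c) ⟨
    zero ≡ dot d c mod P              ∎) (dot c u mod P ≟ dot c v mod P) (zero ≟ dot d c mod P)
    where
    open SetoidReasoning (⇔-setoid 0ℓ)
    d = v ⊕ (q ⊙ u)
    d·c≈ : dot d c ≈ dot c v + q * dot c u
    d·c≈ = ≈-trans (≈-reflexive (dot-comm d c)) (dot-affine c v u q)

  ⊕q⊙≡𝟎⇒≡ : ∀ {m} (v u : Pt P m) → v ⊕ (q ⊙ u) ≡ 𝟎 → v ≡ u
  ⊕q⊙≡𝟎⇒≡ []       []       _  = refl
  ⊕q⊙≡𝟎⇒≡ (v₀ ∷ v) (u₀ ∷ u) eq =
    cong₂ _∷_ (toℕ-injective (≈⇒≡ (toℕ<n v₀) (toℕ<n u₀) v₀≈u₀)) (⊕q⊙≡𝟎⇒≡ v u (proj₂ (∷-injective eq)))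
    where
    v₀≈u₀ : toℕ v₀ ≈ toℕ u₀
    v₀≈u₀ = Equivalence.to (+q*≈0⇔≈ (toℕ v₀) (toℕ u₀))
              (≈-trans (≈-sym (toℕ-⊕⊙-≈ q v₀ u₀)) (≈-reflexive (cong toℕ (proj₁ (∷-injective eq)))))

  hyperplane-size : ∀ {n} (d : Pt P (suc n)) → d ≢ 𝟎 → ∀ t → ∑[ c ∈ allPts P (suc n) ] 𝟙 (onHyperplane d t c) ≡ P ^ n
  hyperplane-size {n} d d≢𝟎 t = trans (Parametrisation.∑-hyperplane (parametrise d d≢𝟎 t) (λ _ → 1)) (∑-allPts-1 P n)

  #agree : ∀ {n} (u v : Pt P (suc n)) →
           ∑[ c ∈ allPts P (suc n) ] 𝟙 (agree c u v) ≡ P ^ n + (if does (v ≟ᵛ u) then q * P ^ n else 0)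
  #agree {n} u v with v ≟ᵛ u
  ... | yes refl = trans (∑-cong (allPts P (suc n)) (λ c → cong 𝟙 (dec-true (dot c u mod P ≟ dot c u mod P) refl)))
                         (∑-allPts-1 P (suc n))
  ... | no v≢u   = begin
    ∑[ c ∈ allPts P (suc n) ] 𝟙 (agree c u v)
      ≡⟨ ∑-cong (allPts P (suc n)) (λ c → cong 𝟙 (agree≡onHyperplane c u v)) ⟩
    ∑[ c ∈ allPts P (suc n) ] 𝟙 (onHyperplane (v ⊕ (q ⊙ u)) zero c)
      ≡⟨ hyperplane-size (v ⊕ (q ⊙ u)) (v≢u ∘ ⊕q⊙≡𝟎⇒≡ v u) zero ⟩
    P ^ n
      ≡⟨ +-identityʳ (P ^ n) ⟨
    P ^ n + 0 ∎
    where open ≡-Reasoning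

  second-moment : ∀ {n} (S : SubsetF P (suc n)) →
                  ∑[ c ∈ allPts P (suc n) ] ∑[ t ∈ allFin P ] (section S c t * section S c t)
                  ≡ P ^ n * (card S * card S) + q * P ^ n * card S
  second-moment {n} S = begin
    ∑[ c ∈ Ps ] ∑[ t ∈ allFin P ] (section S c t * section S c t)
      ≡⟨ ∑-cong Ps (∑-section² S) ⟩
    ∑[ c ∈ Ps ] ∑[ u ∈ Ps ] ∑[ v ∈ Ps ] (if agree c u v then a u * a v else 0)
      ≡⟨ ∑-comm Ps Ps _ ⟩
    ∑[ u ∈ Ps ] ∑[ c ∈ Ps ] ∑[ v ∈ Ps ] (if agree c u v then a u * a v else 0)
      ≡⟨ ∑-cong Ps (λ u → ∑-comm Ps Ps _) ⟩
    ∑[ u ∈ Ps ] ∑[ v ∈ Ps ] ∑[ c ∈ Ps ] (if agree c u v then a u * a v else 0)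
      ≡⟨ ∑-cong Ps (λ u → ∑-cong Ps (λ v → pair-count u v)) ⟩
    ∑[ u ∈ Ps ] ∑[ v ∈ Ps ] ((N + (if does (v ≟ᵛ u) then q * N else 0)) * (a u * a v))
      ≡⟨ ∑-cong Ps row ⟩
    ∑[ u ∈ Ps ] (N * (a u * x) + q * N * a u)
      ≡⟨ ∑-distrib-+ Ps _ _ ⟩
    ∑ Ps (λ u → N * (a u * x)) + ∑ Ps (λ u → q * N * a u)
      ≡⟨ cong₂ _+_ (trans (∑-*ˡ Ps N _) (cong (N *_) (∑-*ʳ Ps x a))) (∑-*ˡ Ps (q * N) a) ⟩
    N * (x * x) + q * N * x ∎
    where
    open ≡-Reasoning
    Ps = allPts P (suc n)
    N = P ^ n
    x = card S
    a : Pt P (suc n) → ℕ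
    a = 𝟙 ∘ S
    pair-count : ∀ u v → ∑[ c ∈ Ps ] (if agree c u v then a u * a v else 0)
                         ≡ (N + (if does (v ≟ᵛ u) then q * N else 0)) * (a u * a v)
    pair-count u v = trans (∑-cong Ps (λ c → if≡𝟙* (agree c u v)))
                           (trans (∑-*ʳ Ps (a u * a v) (λ c → 𝟙 (agree c u v))) (cong (_* (a u * a v)) (#agree u v)))
      where
      if≡𝟙* : ∀ b → (if b then a u * a v else 0) ≡ 𝟙 b * (a u * a v)
      if≡𝟙* true  = sym (+-identityʳ _)
      if≡𝟙* false = refl
    row : ∀ u → ∑[ v ∈ Ps ] ((N + (if does (v ≟ᵛ u) then q * N else 0)) * (a u * a v))
                ≡ N * (a u * x) + q * N * a u
    row u = begin
      ∑[ v ∈ Ps ] ((N + (if does (v ≟ᵛ u) then q * N else 0)) * (a u * a v))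
        ≡⟨ ∑-cong Ps (λ v → split (does (v ≟ᵛ u)) (a u * a v)) ⟩
      ∑[ v ∈ Ps ] (N * (a u * a v) + (if does (v ≟ᵛ u) then q * N * (a u * a v) else 0))
        ≡⟨ ∑-distrib-+ Ps _ _ ⟩
      ∑ Ps (λ v → N * (a u * a v)) + ∑ Ps (λ v → if does (v ≟ᵛ u) then q * N * (a u * a v) else 0)
        ≡⟨ cong₂ _+_ (trans (∑-*ˡ Ps N _) (cong (N *_) (∑-*ˡ Ps (a u) a))) (∑-δᵛ u (λ v → q * N * (a u * a v))) ⟩
      N * (a u * x) + q * N * (a u * a u)
        ≡⟨ cong (λ z → N * (a u * x) + q * N * z) (𝟙*𝟙 (S u)) ⟩
      N * (a u * x) + q * N * a u ∎
      where
      split : ∀ b k → (N + (if b then q * N else 0)) * k ≡ N * k + (if b then q * N * k else 0)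
      split true  k = *-distribʳ-+ k N (q * N)
      split false k = trans (cong (_* k) (+-identityʳ N)) (sym (+-identityʳ (N * k)))

  ∑-section²-𝟎 : ∀ {m} (S : SubsetF P m) → ∑[ t ∈ allFin P ] (section S 𝟎 t * section S 𝟎 t) ≡ card S * card S
  ∑-section²-𝟎 {m} S = begin
    ∑[ t ∈ allFin P ] (section S 𝟎 t * section S 𝟎 t)
      ≡⟨ ∑-section² S 𝟎 ⟩
    ∑[ u ∈ Ps ] ∑[ v ∈ Ps ] (if agree 𝟎 u v then 𝟙 (S u) * 𝟙 (S v) else 0)
      ≡⟨ ∑-cong Ps (λ u → ∑-cong Ps (λ v → cong (λ b → if b then 𝟙 (S u) * 𝟙 (S v) else 0) (agree-𝟎 u v))) ⟩
    ∑[ u ∈ Ps ] ∑[ v ∈ Ps ] (𝟙 (S u) * 𝟙 (S v))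
      ≡⟨ ∑-square Ps (𝟙 ∘ S) ⟨
    card S * card S ∎
    where
    open ≡-Reasoning
    Ps = allPts P m
    agree-𝟎 : ∀ u v → agree 𝟎 u v ≡ true
    agree-𝟎 u v = dec-true (dot 𝟎 u mod P ≟ dot 𝟎 v mod P) (cong (_mod P) (trans (dot-𝟎ˡ u) (sym (dot-𝟎ˡ v))))

  ∑≠𝟎 : ∀ {m} → (Pt P m → ℕ) → ℕ
  ∑≠𝟎 {m} g = ∑[ c ∈ allPts P m ] (if does (c ≟ᵛ 𝟎) then 0 else g c)

  ∑-split-𝟎 : ∀ {m} (g : Pt P m → ℕ) → ∑ (allPts P m) g ≡ ∑≠𝟎 g + g 𝟎
  ∑-split-𝟎 {m} g = begin
    ∑ (allPts P m) g
      ≡⟨ ∑-cong (allPts P m) (λ c → split (does (c ≟ᵛ 𝟎)) (g c)) ⟩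
    ∑[ c ∈ allPts P m ] ((if does (c ≟ᵛ 𝟎) then 0 else g c) + (if does (c ≟ᵛ 𝟎) then g c else 0))
      ≡⟨ ∑-distrib-+ (allPts P m) _ _ ⟩
    ∑≠𝟎 g + ∑ (allPts P m) (λ c → if does (c ≟ᵛ 𝟎) then g c else 0)
      ≡⟨ cong (∑≠𝟎 g +_) (∑-δᵛ 𝟎 g) ⟩
    ∑≠𝟎 g + g 𝟎 ∎
    where
    open ≡-Reasoning
    split : ∀ b k → k ≡ (if b then 0 else k) + (if b then k else 0)
    split true  k = refl
    split false k = sym (+-identityʳ k)

  second-moment-≠𝟎 : ∀ {n} (S : SubsetF P (suc n)) →
                     ∑≠𝟎 (λ c → ∑[ t ∈ allFin P ] section S c t * section S c t) + card S * card S
                     ≡ P ^ n * (card S * card S) + q * P ^ n * card S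
  second-moment-≠𝟎 {n} S = begin
    ∑≠𝟎 g + card S * card S   ≡⟨ cong (∑≠𝟎 g +_) (∑-section²-𝟎 S) ⟨
    ∑≠𝟎 g + g 𝟎               ≡⟨ ∑-split-𝟎 g ⟨
    ∑ (allPts P (suc n)) g    ≡⟨ second-moment S ⟩
    P ^ n * (card S * card S) + q * P ^ n * card S ∎
    where
    open ≡-Reasoning
    g : Pt P (suc n) → ℕ
    g c = ∑[ t ∈ allFin P ] section S c t * section S c t

  #≠𝟎 : ℕ → ℕ
  #≠𝟎 m = ∑≠𝟎 {m} (λ _ → 1)

  #≠𝟎+1 : ∀ m → #≠𝟎 m + 1 ≡ P ^ m
  #≠𝟎+1 m = trans (sym (∑-split-𝟎 {m} (λ _ → 1))) (∑-allPts-1 P m)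

  ∑≠𝟎-bound : ∀ {m} (f : Pt P m → ℕ) (a b : ℕ) → (∀ c → c ≢ 𝟎 → f c + a ≤ b) →
              ∑≠𝟎 f + #≠𝟎 m * a ≤ #≠𝟎 m * b
  ∑≠𝟎-bound {m} f a b f+a≤b = begin
    ∑≠𝟎 f + #≠𝟎 m * a                       ≡⟨ cong (∑≠𝟎 f +_) (∑-*ʳ Ps a 𝟙≠𝟎) ⟨
    ∑≠𝟎 f + ∑ Ps (λ c → 𝟙≠𝟎 c * a)          ≡⟨ ∑-distrib-+ Ps _ _ ⟨
    ∑[ c ∈ Ps ] ((if does (c ≟ᵛ 𝟎) then 0 else f c) + 𝟙≠𝟎 c * a)
                                            ≤⟨ ∑-mono-≤ Ps (λ c → pointwise c (c ≟ᵛ 𝟎)) ⟩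
    ∑[ c ∈ Ps ] (𝟙≠𝟎 c * b)                 ≡⟨ ∑-*ʳ Ps b 𝟙≠𝟎 ⟩
    #≠𝟎 m * b                               ∎
    where
    open ≤-Reasoning
    Ps = allPts P m
    𝟙≠𝟎 : Pt P m → ℕ
    𝟙≠𝟎 c = if does (c ≟ᵛ 𝟎) then 0 else 1
    pointwise : ∀ c (c≟𝟎 : Dec (c ≡ 𝟎)) →
                (if does c≟𝟎 then 0 else f c) + (if does c≟𝟎 then 0 else 1) * a ≤ (if does c≟𝟎 then 0 else 1) * b
    pointwise c (yes _)  = z≤n
    pointwise c (no c≢𝟎) = subst₂ (λ a′ b′ → f c + a′ ≤ b′) (sym (*-identityˡ a)) (sym (*-identityˡ b)) (f+a≤b c c≢𝟎)

  card<-progressionFree : ∀ {k m} (S : SubsetF P (suc m)) → ProgFree k S → card S < P ^ suc m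
  card<-progressionFree S S-free =
    card<-¬full S (λ full → S-free (e₁ , e₁ , Equivalence.to (≢𝟎⇔NonZeroVec e₁) e₁≢𝟎 , λ i _ → full _))

  #≠𝟎≡ : ∀ m → #≠𝟎 m ≡ P ^ m ∸ 1
  #≠𝟎≡ m = trans (sym (m+n∸n≡m (#≠𝟎 m) 1)) (cong (_∸ 1) (#≠𝟎+1 m))

  r-bound : ∀ {k n R} → IsRk P k n R → (S : SubsetF P (suc n)) → ProgFree k S →
            LeqMinusSqrtOver (card S) (2 * (P ^ suc n ∸ 1) * R + P ^ n)
                             (4 * (P ^ suc n ∸ 1) * R * (P ^ n ∸ R) + P ^ (2 * n)) (2 * P ^ n)
  r-bound {k} {n} {R} r S S-free rewrite ^-double P n | sym (#≠𝟎≡ (suc n)) =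
    quadratic-bound q x R m (P ^ n) (#≠𝟎 (suc n)) W 1≤q (#≠𝟎+1 (suc n)) (second-moment-≠𝟎 S)
      (∑≠𝟎-bound _ (P * (R * m)) ((R + m) * x) (λ c c≢𝟎 → ∑-section²≤ S c (bounds c c≢𝟎)))
      x≤m+qR (uncurry ≤-trans (bounds e₁ e₁≢𝟎 zero)) (IsRk⇒≤ r) (card<-progressionFree S S-free)
    where
    x = card S
    m = x ∸ q * R
    W = ∑≠𝟎 (λ c → ∑[ t ∈ allFin P ] section S c t * section S c t)
    bounds : ∀ c → c ≢ 𝟎 → ∀ t → m ≤ section S c t × section S c t ≤ R
    bounds c c≢𝟎 t = section≥ S c (section≤r r S S-free c c≢𝟎) t , section≤r r S S-free c c≢𝟎 t
    x≤m+qR : x ≤ m + q * R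
    x≤m+qR = subst (x ≤_) (+-comm (q * R) m) (m≤n+m∸n x (q * R))

theorem1p3 : (p k n : ℕ) → Prime p → 3 ≤ p → 3 ≤ k → k ≤ p →
    (R : ℕ) → IsRk p k n R →
    (S : SubsetF p (n + 1)) → ProgFree k S →
    LeqMinusSqrtOver (card S)
      (2 * (p ^ (n + 1) ∸ 1) * R + p ^ n)
      (4 * (p ^ (n + 1) ∸ 1) * R * (p ^ n ∸ R) + p ^ (2 * n))
      (2 * p ^ n)
theorem1p3 (suc q) k n p-prime _ _ _ R r S S-free rewrite +-comm n 1 = r-bound r S S-free
  where open Geometry q p-prime
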